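{- Let $\alpha,\nu$ be partitions, regarded as $n$-tuples with $n$ large enough, let $i\in\{1,\dots,n\}$ be such that adding one cell to row $i$ of $\alpha$ yields a partition $\mu={\overrightarrow{\alpha}}^i$, and let $(\lambda,\rho)=(\alpha,\nu)^*$. If there exists $j\in\{1,\dots,n\}$ with $\nu_j-j=\alpha_i-i$, then $(\mu,\nu)^*=(\lambda,{\overrightarrow{\rho}}^j)$, and moreover ${\overrightarrow{\rho}}^j=\rho\!\uparrow_{\mu_i}$ (the added cell of $\rho$ lies in column $\mu_i$); otherwise $(\mu,\nu)^*=({\overrightarrow{\lambda}}^i,\rho)$. Similarly, let $\mu,\beta$ be partitions, let $i$ be such that $\nu={\overrightarrow{\beta}}^i$ is a partition, and let $(\lambda,\rho)=(\mu,\beta)^*$. If there exists $j\in\{1,\dots,n\}$ with $\mu_j-j=\nu_i-i$, then $(\mu,\nu)^*=({\overrightarrow{\lambda}}^j,\rho)$, and moreover ${\overrightarrow{\lambda}}^j=\lambda\!\uparrow_{\nu_i}$; otherwise $(\mu,\nu)^*=(\lambda,{\overrightarrow{\rho}}^i)$.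
   Context: Partitions are weakly decreasing sequences of nonnegative integers, identified up to trailing zeros, drawn in French convention (row $i$ has $\mu_i$ cells). For partitions $\mu,\nu$ written as $n$-tuples ($n\ge$ the number of nonzero parts of each), the $*$-operation is $(\mu,\nu)^*=(\lambda(\mu,\nu),\rho(\mu,\nu))$ with $\lambda_k=\mu_k-k+\#\{j\in\{1,\dots,n\}: \nu_j-j\ge \mu_k-k\}$ and $\rho_j=\nu_j-j+1+\#\{k\in\{1,\dots,n\}:\mu_k-k>\nu_j-j\}$. For a partition $\alpha$, ${\overrightarrow{\alpha}}^i$ denotes the partition obtained by adding one cell in row $i$ (so its $i$-th part is $\alpha_i+1$ and other parts are unchanged), and $\alpha\!\uparrow_c$ denotes the partition obtained from $\alpha$ by adding one cell in column $c$. -}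

module Defs where

open import Data.Nat as N using (ℕ; suc)
open import Data.Integer using (ℤ; +_; _-_; _+_; _≤_; _<_; _≤?_; _<?_)
open import Data.Fin using (Fin; toℕ; _≟_)
open import Data.List using (length; filter)
open import Data.List.Base using (allFin)
open import Data.Product using (Σ; _×_)
open import Relation.Binary.PropositionalEquality using (_≡_)
open import Relation.Nullary using (yes; no)
open import Relation.Unary using (Pred; Decidable)
import Level

-- An n-tuple of natural numbers / integers, rows indexed 0..n-1 (row r is Fin-index r, i.e. paper index r+1).
Tuple : ℕ → Set
Tuple n = Fin n → ℕ

ZTuple : ℕ → Set
ZTuple n = Fin n → ℤ

idx : ∀ {n} → Fin n → ℤ
idx k = + suc (toℕ k)

IsPartition : ∀ {n} → Tuple n → Set
IsPartition {n} a = ∀ (r s : Fin n) → toℕ r N.≤ toℕ s → a s N.≤ a r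

IsZPartition : ∀ {n} → ZTuple n → Set
IsZPartition {n} a = ∀ (r s : Fin n) → toℕ r N.≤ toℕ s → (+ 0 ≤ a s) × (a s ≤ a r)

count : ∀ {n} {P : Pred (Fin n) Level.zero} → Decidable P → ℕ
count {n} P? = length (filter P? (allFin n))

starL : ∀ {n} → Tuple n → Tuple n → ZTuple n
starL μ ν k = ((+ μ k) - idx k) + (+ count (λ j → ((+ μ k) - idx k) ≤? ((+ ν j) - idx j)))

starR : ∀ {n} → Tuple n → Tuple n → ZTuple n
starR μ ν j = (((+ ν j) - idx j) + + 1) + (+ count (λ k → ((+ ν j) - idx j) <? ((+ μ k) - idx k)))

addRow : ∀ {n} → Tuple n → Fin n → Tuple n
addRow a i r with r ≟ i
... | yes _ = suc (a r)
... | no _ = a r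

addRowZ : ∀ {n} → ZTuple n → Fin n → ZTuple n
addRowZ a i r with r ≟ i
... | yes _ = a r + + 1
... | no _ = a r

IsAddColumn : ∀ {n} → ZTuple n → ℕ → ZTuple n → Set
IsAddColumn {n} a c σ = Σ (Fin n) λ r → (∀ s → σ s ≡ addRowZ a r s) × (σ r ≡ + c) × IsZPartition σ

-- Write c_a(k) = a_k - k for the contents of a partition a; they strictly decrease in k.
-- Both halves of the *-operation are values of R_c(x) = x + #{k | x ≤ c(k)} (rankShift):
-- λ_k = R_{c_ν}(c_μ(k)) and ρ_j = R_{c_μ}(c_ν(j) + 1), while adding a cell in row i raises
-- the single content c(i) by one. Two local facts about R then decide everything:
-- R_c(x + 1) is R_c(x) when x is a value of c and R_c(x) + 1 otherwise, and raising c(i)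
-- by one raises R_c(x) by one exactly at x = c(i) + 1. The new cell lies in column a_i
-- because R_{c_a}(c_a(i)) = a_i.
module Submission where

open import Defs
open import Data.Nat as ℕ using (ℕ; zero; suc; z≤n; s≤s)
import Data.Nat.Properties as ℕP
open import Data.Integer as ℤ using (ℤ; +_; -_; _-_; _+_)
import Data.Integer.Properties as ℤP
open import Data.Fin as Fin using (Fin; toℕ; _≟_)
import Data.Fin.Properties as FinP
open import Data.List using (List; []; _∷_; length; filter; map; tabulate)
open import Data.List.Base using (allFin)
open import Data.List.Properties using (filter-accept; filter-reject; filter-≐; filter-all; length-tabulate; map-tabulate)
open import Data.List.Relation.Unary.All.Properties using (tabulate⁺)
open import Data.Bool using (true; false)
open import Data.Product using (_×_; _,_; proj₁; proj₂)
open import Data.Sum using (_⊎_; inj₁; inj₂)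
open import Function using (_∘_; id)
open import Function.Definitions using (Injective)
open import Level using (0ℓ)
open import Relation.Binary.PropositionalEquality
open import Relation.Binary.Definitions using (tri<; tri≈; tri>)
open import Relation.Nullary using (¬_; Dec; yes; no; does; contradiction)
open import Relation.Unary using (Pred; Decidable; _≐_; _∪_; ｛_｝)
open import Algebra.Properties.CommutativeSemigroup ℤP.+-commutativeSemigroup using (xy∙z≈xz∙y; xy∙z≈yz∙x; x∙yz≈xz∙y)
open import Algebra.Properties.AbelianGroup ℤP.+-0-abelianGroup using (xyx⁻¹≈y; ∙-cancelʳ)

length-filter-map : ∀ {A B : Set} {P : Pred B 0ℓ} (P? : Decidable P) (f : A → B) (xs : List A) →
  length (filter P? (map f xs)) ≡ length (filter (P? ∘ f) xs)
length-filter-map P? f [] = refl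
length-filter-map P? f (x ∷ xs) with does (P? (f x))
... | true = cong suc (length-filter-map P? f xs)
... | false = length-filter-map P? f xs

module _ {n : ℕ} {P : Pred (Fin (suc n)) 0ℓ} (P? : Decidable P) where

  private
    count-tail : length (filter P? (tabulate Fin.suc)) ≡ count (P? ∘ Fin.suc)
    count-tail = trans (cong (length ∘ filter P?) (sym (map-tabulate id Fin.suc)))
                       (length-filter-map P? Fin.suc (allFin n))

  count-accept-zero : P Fin.zero → count P? ≡ suc (count (P? ∘ Fin.suc))
  count-accept-zero p = trans (cong length (filter-accept P? p)) (cong suc count-tail)

  count-reject-zero : ¬ P Fin.zero → count P? ≡ count (P? ∘ Fin.suc)
  count-reject-zero ¬p = trans (cong length (filter-reject P? ¬p)) count-tail

count-cong : ∀ {n} {P Q : Pred (Fin n) 0ℓ} (P? : Decidable P) (Q? : Decidable Q) →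
  P ≐ Q → count P? ≡ count Q?
count-cong P? Q? P≐Q = cong length (filter-≐ P? Q? P≐Q (allFin _))

count-all : ∀ {n} {P : Pred (Fin n) 0ℓ} (P? : Decidable P) → (∀ k → P k) → count P? ≡ n
count-all P? all = trans (cong length (filter-all P? (tabulate⁺ all))) (length-tabulate id)

≐∪｛suc｝⇒tail : ∀ {n} {P Q : Pred (Fin (suc n)) 0ℓ} {k₀ : Fin n} →
  Q ≐ P ∪ ｛ Fin.suc k₀ ｝ → (Q ∘ Fin.suc) ≐ (P ∘ Fin.suc) ∪ ｛ k₀ ｝
≐∪｛suc｝⇒tail {P = P} {Q} {k₀} (Q⊆ , Q⊇) = tail⊆ , tail⊇
  where
  tail⊆ : ∀ {k} → Q (Fin.suc k) → P (Fin.suc k) ⊎ k₀ ≡ k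
  tail⊆ q with Q⊆ q
  ... | inj₁ p = inj₁ p
  ... | inj₂ e = inj₂ (FinP.suc-injective e)
  tail⊇ : ∀ {k} → P (Fin.suc k) ⊎ k₀ ≡ k → Q (Fin.suc k)
  tail⊇ (inj₁ p) = Q⊇ (inj₁ p)
  tail⊇ (inj₂ e) = Q⊇ (inj₂ (cong Fin.suc e))

count-insert : ∀ {n} {P Q : Pred (Fin n) 0ℓ} (P? : Decidable P) (Q? : Decidable Q) {k₀ : Fin n} →
  Q ≐ P ∪ ｛ k₀ ｝ → ¬ P k₀ → count Q? ≡ suc (count P?)
count-insert {P = P} {Q} P? Q? {Fin.zero} (Q⊆ , Q⊇) ¬P₀ = begin
  count Q?                   ≡⟨ count-accept-zero Q? (Q⊇ (inj₂ refl)) ⟩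
  suc (count (Q? ∘ Fin.suc)) ≡⟨ cong suc (count-cong (Q? ∘ Fin.suc) (P? ∘ Fin.suc) (tail⊆ , Q⊇ ∘ inj₁)) ⟩
  suc (count (P? ∘ Fin.suc)) ≡⟨ cong suc (sym (count-reject-zero P? ¬P₀)) ⟩
  suc (count P?)             ∎
  where
  open ≡-Reasoning
  tail⊆ : ∀ {k} → Q (Fin.suc k) → P (Fin.suc k)
  tail⊆ q with Q⊆ q
  ... | inj₁ p = p
count-insert {P = P} {Q} P? Q? {Fin.suc k₀} Q≐ ¬P₀ = byHead (P? Fin.zero)
  where
  open ≡-Reasoning
  tail : count (Q? ∘ Fin.suc) ≡ suc (count (P? ∘ Fin.suc))
  tail = count-insert (P? ∘ Fin.suc) (Q? ∘ Fin.suc) (≐∪｛suc｝⇒tail Q≐) ¬P₀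
  byHead : Dec (P Fin.zero) → count Q? ≡ suc (count P?)
  byHead (yes P0) = begin
    count Q?                         ≡⟨ count-accept-zero Q? (proj₂ Q≐ (inj₁ P0)) ⟩
    suc (count (Q? ∘ Fin.suc))       ≡⟨ cong suc tail ⟩
    suc (suc (count (P? ∘ Fin.suc))) ≡⟨ cong suc (sym (count-accept-zero P? P0)) ⟩
    suc (count P?)                   ∎
  byHead (no ¬P0) = begin
    count Q?                   ≡⟨ count-reject-zero Q? ¬Q0 ⟩
    count (Q? ∘ Fin.suc)       ≡⟨ tail ⟩
    suc (count (P? ∘ Fin.suc)) ≡⟨ cong suc (sym (count-reject-zero P? ¬P0)) ⟩
    suc (count P?)             ∎
    where
    ¬Q0 : ¬ Q Fin.zero
    ¬Q0 q with proj₁ Q≐ q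
    ... | inj₁ p = ¬P0 p

count-initial-segment : ∀ {n m} {P : Pred (Fin n) 0ℓ} (P? : Decidable P) →
  m ℕ.≤ n → P ≐ (λ k → toℕ k ℕ.< m) → count P? ≡ m
count-initial-segment {zero} {zero} P? _ _ = refl
count-initial-segment {suc n} {zero} P? _ (P⊆ , _) = begin
  count P?             ≡⟨ count-reject-zero P? (λ p → contradiction (P⊆ p) λ ()) ⟩
  count (P? ∘ Fin.suc) ≡⟨ count-initial-segment (P? ∘ Fin.suc) z≤n ((λ p → contradiction (P⊆ p) λ ()) , λ ()) ⟩
  zero                 ∎
  where open ≡-Reasoning
count-initial-segment {suc n} {suc m} P? (s≤s m≤n) (P⊆ , P⊇) = begin
  count P?                   ≡⟨ count-accept-zero P? (P⊇ (s≤s z≤n)) ⟩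
  suc (count (P? ∘ Fin.suc)) ≡⟨ cong suc (count-initial-segment (P? ∘ Fin.suc) m≤n (ℕP.≤-pred ∘ P⊆ , P⊇ ∘ s≤s)) ⟩
  suc m                      ∎
  where open ≡-Reasoning

<⇒+1≤ : ∀ {x y : ℤ} → x ℤ.< y → x + + 1 ℤ.≤ y
<⇒+1≤ {x} {y} x<y = subst (ℤ._≤ y) (ℤP.+-comm (+ 1) x) (ℤP.i<j⇒suc[i]≤j x<y)

+1≤⇒< : ∀ {x y : ℤ} → x + + 1 ℤ.≤ y → x ℤ.< y
+1≤⇒< {x} {y} x+1≤y = ℤP.suc[i]≤j⇒i<j (subst (ℤ._≤ y) (ℤP.+-comm x (+ 1)) x+1≤y)

x≤x+1 : ∀ (x : ℤ) → x ℤ.≤ x + + 1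
x≤x+1 x = ℤP.<⇒≤ (+1≤⇒< ℤP.≤-refl)

<+1⇒≤ : ∀ {x y : ℤ} → x ℤ.< y + + 1 → x ℤ.≤ y
<+1⇒≤ {x} {y} x<y+1 =
  subst (x ℤ.≤_) (trans (cong ℤ.pred (ℤP.+-comm y (+ 1))) (ℤP.pred-suc y)) (ℤP.i<j⇒i≤pred[j] x<y+1)

+1-injective : ∀ {x y : ℤ} → x + + 1 ≡ y + + 1 → x ≡ y
+1-injective {x} {y} = ∙-cancelʳ (+ 1) x y

+1≰ : ∀ (x : ℤ) → ¬ (x + + 1 ℤ.≤ x)
+1≰ x h = ℤP.<-irrefl refl (+1≤⇒< h)

addRowZ-at : ∀ {n} (a : ZTuple n) i → addRowZ a i i ≡ a i + + 1
addRowZ-at a i with i ≟ i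
... | yes _ = refl
... | no i≢i = contradiction refl i≢i

addRowZ-off : ∀ {n} (a : ZTuple n) {i k} → k ≢ i → addRowZ a i k ≡ a k
addRowZ-off a {i} {k} k≢i with k ≟ i
... | yes k≡i = contradiction k≡i k≢i
... | no _ = refl

content : ∀ {n} → Tuple n → ZTuple n
content a k = + a k - idx k

content-addRow : ∀ {n} (a : Tuple n) i k → content (addRow a i) k ≡ addRowZ (content a) i k
content-addRow a i k with k ≟ i
... | yes _ = begin
  + suc (a k) - idx k        ≡⟨ cong (_- idx k) (ℤP.pos-+ 1 (a k)) ⟩
  (+ 1 + + a k) - idx k      ≡⟨ xy∙z≈yz∙x (+ 1) (+ a k) (- idx k) ⟩
  (+ a k - idx k) + + 1      ∎
  where open ≡-Reasoning
... | no _ = refl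

content-addRow-at : ∀ {n} (a : Tuple n) i → content (addRow a i) i ≡ content a i + + 1
content-addRow-at a i = trans (content-addRow a i i) (addRowZ-at (content a) i)

content-addRow-off : ∀ {n} (a : Tuple n) {i k} → k ≢ i → content (addRow a i) k ≡ content a k
content-addRow-off a {i} {k} k≢i = trans (content-addRow a i k) (addRowZ-off (content a) k≢i)

module _ {n} {a : Tuple n} (pa : IsPartition a) where

  content-antitone : ∀ {r s} → toℕ r ℕ.≤ toℕ s → content a s ℤ.≤ content a r
  content-antitone {r} {s} r≤s = ℤP.+-mono-≤ (ℤ.+≤+ (pa r s r≤s)) (ℤP.neg-mono-≤ (ℤ.+≤+ (s≤s r≤s)))

  content-strict : ∀ {r s} → toℕ r ℕ.< toℕ s → content a s ℤ.< content a r
  content-strict {r} {s} r<s =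
    ℤP.+-mono-≤-< (ℤ.+≤+ (pa r s (ℕP.<⇒≤ r<s))) (ℤP.neg-mono-< (ℤ.+<+ (s≤s r<s)))

  content-injective : Injective _≡_ _≡_ (content a)
  content-injective {r} {s} eq with ℕP.<-cmp (toℕ r) (toℕ s)
  ... | tri< r<s _ _ = contradiction (sym eq) (ℤP.<⇒≢ (content-strict r<s))
  ... | tri≈ _ r≡s _ = FinP.toℕ-injective r≡s
  ... | tri> _ _ s<r = contradiction eq (ℤP.<⇒≢ (content-strict s<r))

content-lowerBound : ∀ {n} (a : Tuple n) k → - + n ℤ.≤ content a k
content-lowerBound {n} a k = begin
  - + n            ≡⟨ sym (ℤP.+-identityˡ (- + n)) ⟩
  + 0 - + n        ≤⟨ ℤP.+-mono-≤ (ℤ.+≤+ {n = a k} z≤n) (ℤP.neg-mono-≤ (ℤ.+≤+ (FinP.toℕ<n k))) ⟩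
  content a k      ∎
  where open ℤP.≤-Reasoning

countAtLeast : ∀ {n} → ZTuple n → ℤ → ℕ
countAtLeast c x = count (λ k → x ℤ.≤? c k)

countAtLeast-cong : ∀ {n} {c d : ZTuple n} → (∀ k → c k ≡ d k) → ∀ x → countAtLeast c x ≡ countAtLeast d x
countAtLeast-cong {c = c} {d} c≗d x =
  count-cong _ _ ((λ {k} → subst (x ℤ.≤_) (c≗d k)) , (λ {k} → subst (x ℤ.≤_) (sym (c≗d k))))

countAtLeast-hit : ∀ {n} {c : ZTuple n} {x k₀} → Injective _≡_ _≡_ c → c k₀ ≡ x →
  countAtLeast c x ≡ suc (countAtLeast c (x + + 1))
countAtLeast-hit {c = c} {x} {k₀} c-inj ck₀≡x =
  count-insert _ _ (⊆ , ⊇) (λ h → +1≰ x (subst (x + + 1 ℤ.≤_) ck₀≡x h))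
  where
  ⊆ : ∀ {k} → x ℤ.≤ c k → x + + 1 ℤ.≤ c k ⊎ k₀ ≡ k
  ⊆ {k} x≤ck with x ℤ.≟ c k
  ... | yes x≡ck = inj₂ (c-inj (trans ck₀≡x x≡ck))
  ... | no x≢ck = inj₁ (<⇒+1≤ (ℤP.≤∧≢⇒< x≤ck x≢ck))
  ⊇ : ∀ {k} → x + + 1 ℤ.≤ c k ⊎ k₀ ≡ k → x ℤ.≤ c k
  ⊇ (inj₁ x+1≤ck) = ℤP.≤-trans (x≤x+1 x) x+1≤ck
  ⊇ (inj₂ refl) = ℤP.≤-reflexive (sym ck₀≡x)

countAtLeast-miss : ∀ {n} {c : ZTuple n} {x} → (∀ k → c k ≢ x) →
  countAtLeast c x ≡ countAtLeast c (x + + 1)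
countAtLeast-miss {c = c} {x} x∉c = count-cong _ _
  ( (λ {k} x≤ck → <⇒+1≤ (ℤP.≤∧≢⇒< x≤ck (x∉c k ∘ sym)))
  , (λ {k} x+1≤ck → ℤP.≤-trans (x≤x+1 x) x+1≤ck))

countAtLeast-addRowZ-hit : ∀ {n} (c : ZTuple n) {i x} → x ≡ c i + + 1 →
  countAtLeast (addRowZ c i) x ≡ suc (countAtLeast c x)
countAtLeast-addRowZ-hit c {i} {x} x≡ci+1 =
  count-insert _ _ (⊆ , ⊇) (λ x≤ci → +1≰ (c i) (subst (ℤ._≤ c i) x≡ci+1 x≤ci))
  where
  ⊆ : ∀ {k} → x ℤ.≤ addRowZ c i k → x ℤ.≤ c k ⊎ i ≡ k
  ⊆ {k} h with k ≟ i
  ... | yes refl = inj₂ refl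
  ... | no _ = inj₁ h
  ⊇ : ∀ {k} → x ℤ.≤ c k ⊎ i ≡ k → x ℤ.≤ addRowZ c i k
  ⊇ {k} (inj₁ x≤ck) with k ≟ i
  ... | yes refl = ℤP.≤-reflexive x≡ci+1
  ... | no _ = x≤ck
  ⊇ (inj₂ refl) = ℤP.≤-reflexive (trans x≡ci+1 (sym (addRowZ-at c i)))

countAtLeast-addRowZ-miss : ∀ {n} (c : ZTuple n) {i x} → x ≢ c i + + 1 →
  countAtLeast (addRowZ c i) x ≡ countAtLeast c x
countAtLeast-addRowZ-miss c {i} {x} x≢ci+1 = count-cong (λ k → x ℤ.≤? addRowZ c i k) (λ k → x ℤ.≤? c k) (⊆ , ⊇)
  where
  ⊆ : ∀ {k} → x ℤ.≤ addRowZ c i k → x ℤ.≤ c k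
  ⊆ {k} h with k ≟ i
  ... | yes refl = <+1⇒≤ (ℤP.≤∧≢⇒< h x≢ci+1)
  ... | no _ = h
  ⊇ : ∀ {k} → x ℤ.≤ c k → x ℤ.≤ addRowZ c i k
  ⊇ {k} h with k ≟ i
  ... | yes refl = ℤP.≤-trans h (x≤x+1 (c i))
  ... | no _ = h

rankShift : ∀ {n} → ZTuple n → ℤ → ℤ
rankShift c x = x + + countAtLeast c x

+-pos-suc : ∀ (x : ℤ) m → x + + suc m ≡ (x + + m) + + 1
+-pos-suc x m = trans (cong (_+_ x) (ℤP.pos-+ 1 m)) (x∙yz≈xz∙y x (+ 1) (+ m))

rankShift-cong : ∀ {n} {c d : ZTuple n} → (∀ k → c k ≡ d k) → ∀ x → rankShift c x ≡ rankShift d x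
rankShift-cong c≗d x = cong (λ m → x + + m) (countAtLeast-cong c≗d x)

rankShift-suc-hit : ∀ {n} {c : ZTuple n} {x k₀} → Injective _≡_ _≡_ c → c k₀ ≡ x →
  rankShift c (x + + 1) ≡ rankShift c x
rankShift-suc-hit {c = c} {x} c-inj ck₀≡x = begin
  (x + + 1) + + countAtLeast c (x + + 1)   ≡⟨ ℤP.+-assoc x (+ 1) _ ⟩
  x + (+ 1 + + countAtLeast c (x + + 1))   ≡⟨ cong (_+_ x) (sym (ℤP.pos-+ 1 _)) ⟩
  x + + suc (countAtLeast c (x + + 1))     ≡⟨ cong (λ m → x + + m) (sym (countAtLeast-hit c-inj ck₀≡x)) ⟩
  rankShift c x                            ∎
  where open ≡-Reasoning

rankShift-suc-miss : ∀ {n} {c : ZTuple n} {x} → (∀ k → c k ≢ x) →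
  rankShift c (x + + 1) ≡ rankShift c x + + 1
rankShift-suc-miss {c = c} {x} x∉c = begin
  (x + + 1) + + countAtLeast c (x + + 1)   ≡⟨ cong (λ m → (x + + 1) + + m) (sym (countAtLeast-miss x∉c)) ⟩
  (x + + 1) + + countAtLeast c x           ≡⟨ xy∙z≈xz∙y x (+ 1) _ ⟩
  rankShift c x + + 1                      ∎
  where open ≡-Reasoning

rankShift-addRowZ-hit : ∀ {n} (c : ZTuple n) {i x} → x ≡ c i + + 1 →
  rankShift (addRowZ c i) x ≡ rankShift c x + + 1
rankShift-addRowZ-hit c {x = x} x≡ci+1 =
  trans (cong (λ m → x + + m) (countAtLeast-addRowZ-hit c x≡ci+1)) (+-pos-suc x _)

rankShift-addRowZ-miss : ∀ {n} (c : ZTuple n) {i x} → x ≢ c i + + 1 →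
  rankShift (addRowZ c i) x ≡ rankShift c x
rankShift-addRowZ-miss c {x = x} x≢ci+1 = cong (λ m → x + + m) (countAtLeast-addRowZ-miss c x≢ci+1)

module _ {n} {c : ZTuple n} (c-inj : Injective _≡_ _≡_ c) where

  rankShift-≤-suc : ∀ x → rankShift c x ℤ.≤ rankShift c (x + + 1)
  rankShift-≤-suc x with FinP.any? (λ k → c k ℤ.≟ x)
  ... | yes (k₀ , ck₀≡x) = ℤP.≤-reflexive (sym (rankShift-suc-hit c-inj ck₀≡x))
  ... | no x∉c = subst (rankShift c x ℤ.≤_) (sym (rankShift-suc-miss (λ k ck≡x → x∉c (k , ck≡x))))
                        (x≤x+1 (rankShift c x))

  rankShift-≤-+ : ∀ x d → rankShift c x ℤ.≤ rankShift c (x + + d)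
  rankShift-≤-+ x zero = ℤP.≤-reflexive (cong (rankShift c) (sym (ℤP.+-identityʳ x)))
  rankShift-≤-+ x (suc d) = begin
    rankShift c x                   ≤⟨ rankShift-≤-suc x ⟩
    rankShift c (x + + 1)           ≤⟨ rankShift-≤-+ (x + + 1) d ⟩
    rankShift c ((x + + 1) + + d)   ≡⟨ cong (rankShift c) (ℤP.+-assoc x (+ 1) (+ d)) ⟩
    rankShift c (x + (+ 1 + + d))   ≡⟨ cong (λ z → rankShift c (x + z)) (sym (ℤP.pos-+ 1 d)) ⟩
    rankShift c (x + + suc d)       ∎
    where open ℤP.≤-Reasoning

  rankShift-mono : ∀ {x y} → x ℤ.≤ y → rankShift c x ℤ.≤ rankShift c y
  rankShift-mono {x} {y} x≤y = subst (λ z → rankShift c x ℤ.≤ rankShift c z) x+[y-x]≡y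
    (rankShift-≤-+ x ℤ.∣ y - x ∣)
    where
    x+[y-x]≡y : x + + ℤ.∣ y - x ∣ ≡ y
    x+[y-x]≡y = begin
      x + + ℤ.∣ y - x ∣  ≡⟨ cong (_+_ x) (ℤP.0≤i⇒+∣i∣≡i (ℤP.i≤j⇒0≤j-i x≤y)) ⟩
      x + (y - x)        ≡⟨ sym (ℤP.+-assoc x y (- x)) ⟩
      x + y - x          ≡⟨ xyx⁻¹≈y x y ⟩
      y                  ∎
      where open ≡-Reasoning

  rankShift-nonneg : (∀ k → - + n ℤ.≤ c k) → ∀ {x} → - + n ℤ.≤ x → + 0 ℤ.≤ rankShift c x
  rankShift-nonneg c≥-n {x} -n≤x = begin
    + 0                     ≡⟨ sym (ℤP.+-inverseˡ (+ n)) ⟩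
    - + n + + n             ≡⟨ cong (λ m → - + n + + m) (sym (count-all _ c≥-n)) ⟩
    rankShift c (- + n)     ≤⟨ rankShift-mono -n≤x ⟩
    rankShift c x           ∎
    where open ℤP.≤-Reasoning

module _ {n} {a : Tuple n} (pa : IsPartition a) where

  countAtLeast-content : ∀ i → countAtLeast (content a) (content a i) ≡ suc (toℕ i)
  countAtLeast-content i = count-initial-segment _ (FinP.toℕ<n i)
    ( (λ {j} ci≤cj → s≤s (ℕP.≮⇒≥ (λ i<j → ℤP.<⇒≱ (content-strict pa i<j) ci≤cj)))
    , (λ {j} j<1+i → content-antitone pa (ℕP.≤-pred j<1+i)) )

  rankShift-content : ∀ i → rankShift (content a) (content a i) ≡ + a i
  rankShift-content i = begin
    rankShift (content a) (content a i) ≡⟨ cong (_+_ (content a i) ∘ +_) (countAtLeast-content i) ⟩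
    (+ a i - idx i) + idx i             ≡⟨ ℤP.+-assoc (+ a i) (- idx i) (idx i) ⟩
    + a i + (- idx i + idx i)           ≡⟨ cong (_+_ (+ a i)) (ℤP.+-inverseˡ (idx i)) ⟩
    + a i + + 0                         ≡⟨ ℤP.+-identityʳ (+ a i) ⟩
    + a i                               ∎
    where open ≡-Reasoning

starR-rankShift : ∀ {n} (μ ν : Tuple n) j → starR μ ν j ≡ rankShift (content μ) (content ν j + + 1)
starR-rankShift μ ν j = cong (λ m → (content ν j + + 1) + + m) (count-cong (λ k → content ν j ℤ.<? content μ k) _ (<⇒+1≤ , +1≤⇒<))

isZPartition-cong : ∀ {n} {f g : ZTuple n} → (∀ k → f k ≡ g k) → IsZPartition f → IsZPartition g
isZPartition-cong f≗g pf r s r≤s with pf r s r≤s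
... | 0≤fs , fs≤fr = subst (+ 0 ℤ.≤_) (f≗g s) 0≤fs , subst₂ ℤ._≤_ (f≗g s) (f≗g r) fs≤fr

isZPartition-rankShift : ∀ {n} {c x : ZTuple n} → Injective _≡_ _≡_ c →
  (∀ k → - + n ℤ.≤ c k) → (∀ k → - + n ℤ.≤ x k) →
  (∀ {r s} → toℕ r ℕ.≤ toℕ s → x s ℤ.≤ x r) → IsZPartition (λ k → rankShift c (x k))
isZPartition-rankShift c-inj c≥-n x≥-n x-antitone r s r≤s =
  rankShift-nonneg c-inj c≥-n (x≥-n s) , rankShift-mono c-inj (x-antitone r≤s)

module _ {n} {μ ν : Tuple n} (pμ : IsPartition μ) (pν : IsPartition ν) where

  isZPartition-starL : IsZPartition (starL μ ν)
  isZPartition-starL = isZPartition-rankShift (content-injective pν)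
    (content-lowerBound ν) (content-lowerBound μ) (content-antitone pμ)

  isZPartition-starR : IsZPartition (starR μ ν)
  isZPartition-starR = isZPartition-cong (sym ∘ starR-rankShift μ ν)
    (isZPartition-rankShift (content-injective pμ) (content-lowerBound μ)
      (λ k → ℤP.≤-trans (content-lowerBound ν k) (x≤x+1 (content ν k)))
      (λ r≤s → ℤP.+-monoˡ-≤ (+ 1) (content-antitone pν r≤s)))

pointwise-split : ∀ {n} {f g : ZTuple n} i → f i ≡ g i → (∀ k → k ≢ i → f k ≡ g k) → ∀ k → f k ≡ g k
pointwise-split i at off k with k ≟ i
... | yes refl = at
... | no k≢i = off k k≢i

pointwise-addRowZ-split : ∀ {n} {f g : ZTuple n} i → f i ≡ g i + + 1 → (∀ k → k ≢ i → f k ≡ g k) →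
  ∀ k → f k ≡ addRowZ g i k
pointwise-addRowZ-split i at off k with k ≟ i
... | yes refl = at
... | no k≢i = off k k≢i

isAddColumn-intro : ∀ {n} {a σ : ZTuple n} {c : ℕ} r → (∀ k → σ k ≡ addRowZ a r k) →
  IsZPartition σ → σ r ≡ + c → IsAddColumn a c (addRowZ a r)
isAddColumn-intro r σ≗ pσ σr≡c = r , (λ _ → refl) , trans (sym (σ≗ r)) σr≡c , isZPartition-cong σ≗ pσ

module AddCellLeft {n} {α ν : Tuple n} {i : Fin n} (pν : IsPartition ν) where

  starL-off : ∀ k → k ≢ i → starL (addRow α i) ν k ≡ starL α ν k
  starL-off k k≢i = cong (rankShift (content ν)) (content-addRow-off α k≢i)

  starL-at : starL (addRow α i) ν i ≡ rankShift (content ν) (content α i + + 1)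
  starL-at = cong (rankShift (content ν)) (content-addRow-at α i)

  starR-bumped : ∀ k → starR (addRow α i) ν k ≡ rankShift (addRowZ (content α) i) (content ν k + + 1)
  starR-bumped k = trans (starR-rankShift (addRow α i) ν k) (rankShift-cong (content-addRow α i) (content ν k + + 1))

  starR-miss : ∀ k → content ν k ≢ content α i → starR (addRow α i) ν k ≡ starR α ν k
  starR-miss k ck≢ci = begin
    starR (addRow α i) ν k                                    ≡⟨ starR-bumped k ⟩
    rankShift (addRowZ (content α) i) (content ν k + + 1)     ≡⟨ rankShift-addRowZ-miss (content α) (ck≢ci ∘ +1-injective) ⟩
    rankShift (content α) (content ν k + + 1)                 ≡⟨ starR-rankShift α ν k ⟨
    starR α ν k                                               ∎
    where open ≡-Reasoning

  hit : IsPartition (addRow α i) → ∀ j → content ν j ≡ content α i →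
      (∀ k → starL (addRow α i) ν k ≡ starL α ν k)
    × (∀ k → starR (addRow α i) ν k ≡ addRowZ (starR α ν) j k)
    × IsAddColumn (starR α ν) (addRow α i i) (addRowZ (starR α ν) j)
  hit pμ j cj≡ci = L , R , isAddColumn-intro j R (isZPartition-starR pμ pν) column
    where
    open ≡-Reasoning
    L : ∀ k → starL (addRow α i) ν k ≡ starL α ν k
    L = pointwise-split i (trans starL-at (rankShift-suc-hit (content-injective pν) cj≡ci)) starL-off
    R-at : starR (addRow α i) ν j ≡ starR α ν j + + 1
    R-at = begin
      starR (addRow α i) ν j                                 ≡⟨ starR-bumped j ⟩
      rankShift (addRowZ (content α) i) (content ν j + + 1)  ≡⟨ rankShift-addRowZ-hit (content α) (cong (_+ + 1) cj≡ci) ⟩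
      rankShift (content α) (content ν j + + 1) + + 1        ≡⟨ cong (_+ + 1) (starR-rankShift α ν j) ⟨
      starR α ν j + + 1                                      ∎
    R : ∀ k → starR (addRow α i) ν k ≡ addRowZ (starR α ν) j k
    R = pointwise-addRowZ-split j R-at
          (λ k k≢j → starR-miss k (λ ck≡ci → k≢j (content-injective pν (trans ck≡ci (sym cj≡ci)))))
    column : starR (addRow α i) ν j ≡ + addRow α i i
    column = begin
      starR (addRow α i) ν j                                   ≡⟨ starR-rankShift (addRow α i) ν j ⟩
      rankShift (content (addRow α i)) (content ν j + + 1)     ≡⟨ cong (rankShift (content (addRow α i))) (trans (cong (_+ + 1) cj≡ci) (sym (content-addRow-at α i))) ⟩
      rankShift (content (addRow α i)) (content (addRow α i) i) ≡⟨ rankShift-content pμ i ⟩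
      + addRow α i i                                           ∎

  miss : (∀ j → content ν j ≢ content α i) →
      (∀ k → starL (addRow α i) ν k ≡ addRowZ (starL α ν) i k)
    × (∀ k → starR (addRow α i) ν k ≡ starR α ν k)
  miss ci∉cν = pointwise-addRowZ-split i (trans starL-at (rankShift-suc-miss ci∉cν)) starL-off
             , (λ k → starR-miss k (ci∉cν k))

module AddCellRight {n} {μ β : Tuple n} {i : Fin n} (pμ : IsPartition μ) where

  starL-bumped : ∀ k → starL μ (addRow β i) k ≡ rankShift (addRowZ (content β) i) (content μ k)
  starL-bumped k = rankShift-cong (content-addRow β i) (content μ k)

  starL-miss : ∀ k → content μ k ≢ content (addRow β i) i → starL μ (addRow β i) k ≡ starL μ β k
  starL-miss k ck≢ci = trans (starL-bumped k)
    (rankShift-addRowZ-miss (content β) (λ ck≡ci+1 → ck≢ci (trans ck≡ci+1 (sym (content-addRow-at β i)))))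

  starR-off : ∀ k → k ≢ i → starR μ (addRow β i) k ≡ starR μ β k
  starR-off k k≢i = begin
    starR μ (addRow β i) k                               ≡⟨ starR-rankShift μ (addRow β i) k ⟩
    rankShift (content μ) (content (addRow β i) k + + 1) ≡⟨ cong (rankShift (content μ) ∘ (_+ + 1)) (content-addRow-off β k≢i) ⟩
    rankShift (content μ) (content β k + + 1)            ≡⟨ starR-rankShift μ β k ⟨
    starR μ β k                                          ∎
    where open ≡-Reasoning

  starR-at : starR μ (addRow β i) i ≡ rankShift (content μ) (content (addRow β i) i + + 1)
  starR-at = starR-rankShift μ (addRow β i) i

  starR-before-at : starR μ β i ≡ rankShift (content μ) (content (addRow β i) i)
  starR-before-at = trans (starR-rankShift μ β i) (cong (rankShift (content μ)) (sym (content-addRow-at β i)))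

  hit : IsPartition (addRow β i) → ∀ j → content μ j ≡ content (addRow β i) i →
      (∀ k → starL μ (addRow β i) k ≡ addRowZ (starL μ β) j k)
    × (∀ k → starR μ (addRow β i) k ≡ starR μ β k)
    × IsAddColumn (starL μ β) (addRow β i i) (addRowZ (starL μ β) j)
  hit pν j cj≡ci = L , R , isAddColumn-intro j L (isZPartition-starL pμ pν) column
    where
    L : ∀ k → starL μ (addRow β i) k ≡ addRowZ (starL μ β) j k
    L = pointwise-addRowZ-split j
          (trans (starL-bumped j) (rankShift-addRowZ-hit (content β) (trans cj≡ci (content-addRow-at β i))))
          (λ k k≢j → starL-miss k (λ ck≡ci → k≢j (content-injective pμ (trans ck≡ci (sym cj≡ci)))))
    R : ∀ k → starR μ (addRow β i) k ≡ starR μ β k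
    R = pointwise-split i
          (trans starR-at (trans (rankShift-suc-hit (content-injective pμ) cj≡ci) (sym starR-before-at)))
          starR-off
    column : starL μ (addRow β i) j ≡ + addRow β i i
    column = trans (cong (rankShift (content (addRow β i))) cj≡ci) (rankShift-content pν i)

  miss : (∀ j → content μ j ≢ content (addRow β i) i) →
      (∀ k → starL μ (addRow β i) k ≡ starL μ β k)
    × (∀ k → starR μ (addRow β i) k ≡ addRowZ (starR μ β) i k)
  miss ci∉cμ = (λ k → starL-miss k (ci∉cμ k))
             , pointwise-addRowZ-split i
                 (trans starR-at (trans (rankShift-suc-miss ci∉cμ) (cong (_+ + 1) (sym starR-before-at))))
                 starR-off

proposition2p1 :
    (∀ (n : ℕ) (α ν : Tuple n) (i : Fin n) →
      IsPartition α → IsPartition ν → IsPartition (addRow α i) →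
      (∀ (j : Fin n) → (+ ν j) - idx j ≡ (+ α i) - idx i →
          (∀ k → starL (addRow α i) ν k ≡ starL α ν k)
        × (∀ k → starR (addRow α i) ν k ≡ addRowZ (starR α ν) j k)
        × IsAddColumn (starR α ν) (addRow α i i) (addRowZ (starR α ν) j))
      × ((∀ (j : Fin n) → (+ ν j) - idx j ≢ (+ α i) - idx i) →
          (∀ k → starL (addRow α i) ν k ≡ addRowZ (starL α ν) i k)
        × (∀ k → starR (addRow α i) ν k ≡ starR α ν k)))
    ×
    (∀ (n : ℕ) (μ β : Tuple n) (i : Fin n) →
      IsPartition μ → IsPartition β → IsPartition (addRow β i) →
      (∀ (j : Fin n) → (+ μ j) - idx j ≡ (+ addRow β i i) - idx i →
          (∀ k → starL μ (addRow β i) k ≡ addRowZ (starL μ β) j k)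
        × (∀ k → starR μ (addRow β i) k ≡ starR μ β k)
        × IsAddColumn (starL μ β) (addRow β i i) (addRowZ (starL μ β) j))
      × ((∀ (j : Fin n) → (+ μ j) - idx j ≢ (+ addRow β i i) - idx i) →
          (∀ k → starL μ (addRow β i) k ≡ starL μ β k)
        × (∀ k → starR μ (addRow β i) k ≡ addRowZ (starR μ β) i k)))
proposition2p1 =
    (λ n α ν i _ pν pμ → AddCellLeft.hit pν pμ , AddCellLeft.miss pν)
  , (λ n μ β i pμ _ pν → AddCellRight.hit pμ pν , AddCellRight.miss pμ)
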